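{- Let $G=(V,E)$ be a finite graph and $m\ge 2$. Then $\mathrm{c\text{ - }rk}\,G\ge m$ if and only if there exist $v,w\in V$ such that $\mathrm{St}(v)\neq\mathrm{St}(w)$ and $\mathrm{c\text{ - }rk}_{G-\{v,w\}}(\mathrm{St}(v)\cap\mathrm{St}(w))\ge m-2$.
   Context: Graphs are finite, undirected, without loops or multiple edges. $\mathrm{St}(v)$ is the set of vertices adjacent to $v$. For a graph $H=(U,F)$, $A_H^c$ is the $U\times U$ boolean matrix with $(i,j)$ entry $0$ if $\{i,j\}\in F$ and $1$ otherwise. Over the superboolean semiring $\mathbb{SB}=\{0,1,1^\nu\}$ (addition $0+x=x$, $1+1=1^\nu$, $1^\nu+x=1^\nu$; multiplication $0\cdot x=0$, $1\cdot1=1$, $1\cdot1^\nu=1^\nu\cdot1^\nu=1^\nu$), vectors $C_1,\dots,C_k$ are dependent if some $\sum\lambda_iC_i$ with $\lambda_i\in\{0,1\}$ not all zero has all coordinates in $\{0,1^\nu\}$, and independent otherwise. For $J\subseteq U$, $\mathrm{c\text{ - }rk}_H J$ is the maximum number of independent columns of $A^c_H$ among those indexed by $J$ (the rank of $A_H^c[U,J]$), and $\mathrm{c\text{ - }rk}\,H=\mathrm{c\text{ - }rk}_H U$. For $X\subseteq V$, $G-X$ is the graph obtained from $G$ by deleting the vertices of $X$ and all edges incident to them. -}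

module Defs where

open import Data.Nat using (ℕ; zero; suc; _≤_; _∸_)
open import Data.Fin using (Fin; zero; suc)
open import Data.Bool using (Bool; true; false; _∧_; not)
open import Data.Product using (Σ; _×_; ∃; ∃-syntax)
open import Data.Empty using (⊥)
open import Relation.Nullary using (¬_)
open import Relation.Binary.PropositionalEquality using (_≡_; _≢_)
open import Function.Definitions using (Injective)

record Graph (n : ℕ) : Set where
  field
    adj   : Fin n → Fin n → Bool
    sym   : ∀ u v → adj u v ≡ adj v u
    irrefl : ∀ v → adj v v ≡ false
open Graph public

VSet : ℕ → Set
VSet n = Fin n → Bool

_∈_ : ∀ {n} → Fin n → VSet n → Set
i ∈ U = U i ≡ true

data SB : Set where
  𝟘 𝟙 𝟙ν : SB

_+ˢ_ : SB → SB → SB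
𝟘  +ˢ x  = x
𝟙  +ˢ 𝟘  = 𝟙
𝟙  +ˢ 𝟙  = 𝟙ν
𝟙  +ˢ 𝟙ν = 𝟙ν
𝟙ν +ˢ _  = 𝟙ν

_*ˢ_ : SB → SB → SB
𝟘  *ˢ _  = 𝟘
𝟙  *ˢ x  = x
𝟙ν *ˢ 𝟘  = 𝟘
𝟙ν *ˢ 𝟙  = 𝟙ν
𝟙ν *ˢ 𝟙ν = 𝟙ν

toSB : Bool → SB
toSB false = 𝟘
toSB true  = 𝟙

sumSB : ∀ k → (Fin k → SB) → SB
sumSB zero    f = 𝟘
sumSB (suc k) f = f zero +ˢ sumSB k (λ j → f (suc j))

ZeroOrGhost : SB → Set
ZeroOrGhost 𝟘  = Data.Unit.⊤ where import Data.Unit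
ZeroOrGhost 𝟙  = ⊥
ZeroOrGhost 𝟙ν = Data.Unit.⊤ where import Data.Unit

-- Vectors with coordinates indexed by the rows in U (a vertex set of Fin n).
Dependent : ∀ {n} (U : VSet n) (k : ℕ) → (Fin k → Fin n → SB) → Set
Dependent {n} U k C =
  Σ (Fin k → Bool) λ λs →
    (∃[ j ] λs j ≡ true) ×
    (∀ (i : Fin n) → i ∈ U → ZeroOrGhost (sumSB k (λ j → toSB (λs j) *ˢ C j i)))

Independent : ∀ {n} (U : VSet n) (k : ℕ) → (Fin k → Fin n → SB) → Set
Independent U k C = ¬ Dependent U k C

-- Complement adjacency matrix A^c_H of the induced subgraph H = G[U]:
-- entry (i,j) (i,j ∈ U) is 0 if {i,j} is an edge, 1 otherwise.
Ac : ∀ {n} → Graph n → Fin n → Fin n → SB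
Ac G i j = toSB (not (adj G i j))

-- c-rk_{G[U]} J ≥ m  (for J ⊆ U): there are k ≥ m distinct columns of A^c_{G[U]}
-- indexed by elements of J which are independent (vectors indexed by the rows in U).
-- Since c-rk is the maximum such k, this is exactly "c-rk ≥ m".
CRkAtLeast : ∀ {n} → Graph n → (U J : VSet n) → ℕ → Set
CRkAtLeast {n} G U J m =
  ∃[ k ] (m ≤ k) × Σ (Fin k → Fin n) λ c →
    Injective _≡_ _≡_ c ×
    (∀ j → c j ∈ J) ×
    Independent U k (λ j i → Ac G i (c j))

full : ∀ {n} → VSet n
full _ = true

minus2 : ∀ {n} → Fin n → Fin n → VSet n
minus2 v w u with u Data.Fin.≟ v | u Data.Fin.≟ w
... | Relation.Nullary.yes _ | _ = false
... | Relation.Nullary.no _  | Relation.Nullary.yes _ = false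
... | Relation.Nullary.no _  | Relation.Nullary.no _  = true

commonNbrs : ∀ {n} → Graph n → Fin n → Fin n → VSet n
commonNbrs G v w u = adj G v u ∧ adj G w u

StDiffer : ∀ {n} → Graph n → Fin n → Fin n → Set
StDiffer G v w = ¬ (∀ u → adj G v u ≡ adj G w u)

module Submission where

-- Columns col t of A^c are *triangular* for a total preorder ≼ on keys if some rows
-- row t have A^c(row t, col t) = 1 and A^c(row t, col s) = 0 whenever s ≠ t and
-- key t ≼ key s.  Triangular columns are independent over SB (the row of a least-key
-- column in the support of a combination sums to 1); conversely an independent family
-- has a row with exactly one entry 1 among its columns, and peeling that column off
-- recursively makes it triangular for ≤.  Triangularity survives subfamilies,
-- transposition (A^c is symmetric; the order reverses) and adjoining a pivot column.
-- Forward: the columns a, b of the two largest keys give v = col a, w = col b; row a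
-- separates St(v) from St(w), and the other pivots, transposed, are triangular inside
-- G-{v,w} with columns in St(v) ∩ St(w).  Backward: for u ∈ St(w) ∖ St(v), adjoin the
-- pivots (column u, row v), (column w, row w) and transpose.

open import Defs
open import Data.Nat using (ℕ; _≤_; _∸_)
open import Data.Fin using (Fin)
open import Data.Product using (∃-syntax; _×_)
open import Function.Bundles using (_⇔_)

open import Data.Nat using (zero; suc; _≥_; s≤s)
open import Data.Nat.Properties using (≤-isTotalPreorder; ≤-total; ≤-trans; ∸-monoˡ-≤; m≤n+m∸n; +-monoʳ-≤)
open import Data.Fin using (zero; suc; punchIn; punchOut; _≟_)
open import Data.Fin.Properties using (any?; ¬∀⟶∃¬; punchIn-injective; punchInᵢ≢i; punchIn-punchOut)
open import Data.Vec.Functional using (insertAt)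
open import Data.Vec.Functional.Properties using (insertAt-lookup; insertAt-punchIn)
open import Data.Bool using (Bool; true; false; not; _∧_)
open import Data.Bool.Properties using (∧-conicalˡ; ∧-conicalʳ) renaming (_≟_ to _≟ᵇ_)
open import Data.Product using (Σ-syntax; _,_; proj₁; proj₂)
open import Data.Sum using (_⊎_; inj₁; inj₂)
open import Data.Unit using (tt)
open import Function using (_∘_; flip)
open import Function.Bundles using (mk⇔)
open import Function.Definitions using (Injective)
open import Level using (0ℓ)
open import Relation.Binary using (Rel; IsTotalPreorder; Total)
import Relation.Binary.Construct.Flip.EqAndOrd as Flip
open import Relation.Nullary using (¬_; Dec; yes; no; contradiction)
open import Relation.Nullary.Decidable using (_→-dec_; decidable-stable)
open import Relation.Binary.PropositionalEquality
  using (_≡_; _≢_; refl; trans; cong; cong₂; subst; subst₂; module ≡-Reasoning)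
  renaming (sym to ≡-sym)

+ˢ-leftComm : ∀ x y z → x +ˢ (y +ˢ z) ≡ y +ˢ (x +ˢ z)
+ˢ-leftComm 𝟘  y  z = refl
+ˢ-leftComm 𝟙  𝟘  z = refl
+ˢ-leftComm 𝟙  𝟙  z = refl
+ˢ-leftComm 𝟙  𝟙ν z = refl
+ˢ-leftComm 𝟙ν 𝟘  z = refl
+ˢ-leftComm 𝟙ν 𝟙  z = refl
+ˢ-leftComm 𝟙ν 𝟙ν z = refl

+ˢ-zero⁻¹ : ∀ x y → x +ˢ y ≡ 𝟘 → x ≡ 𝟘 × y ≡ 𝟘
+ˢ-zero⁻¹ 𝟘  y  y≡𝟘 = refl , y≡𝟘
+ˢ-zero⁻¹ 𝟙  𝟘  ()
+ˢ-zero⁻¹ 𝟙  𝟙  ()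
+ˢ-zero⁻¹ 𝟙  𝟙ν ()
+ˢ-zero⁻¹ 𝟙ν y  ()

+ˢ-one⁻¹ : ∀ x y → x +ˢ y ≡ 𝟙 → (x ≡ 𝟘 × y ≡ 𝟙) ⊎ (x ≡ 𝟙 × y ≡ 𝟘)
+ˢ-one⁻¹ 𝟘 y y≡𝟙 = inj₁ (refl , y≡𝟙)
+ˢ-one⁻¹ 𝟙 𝟘 _   = inj₂ (refl , refl)
+ˢ-one⁻¹ 𝟙 𝟙 ()
+ˢ-one⁻¹ 𝟙 𝟙ν ()
+ˢ-one⁻¹ 𝟙ν y ()

sumSB-cong : ∀ k {f g : Fin k → SB} → (∀ j → f j ≡ g j) → sumSB k f ≡ sumSB k g
sumSB-cong zero    f≗g = refl
sumSB-cong (suc k) f≗g = cong₂ _+ˢ_ (f≗g zero) (sumSB-cong k (f≗g ∘ suc))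

sumSB-zero : ∀ k (f : Fin k → SB) → (∀ j → f j ≡ 𝟘) → sumSB k f ≡ 𝟘
sumSB-zero zero    f f≡𝟘 = refl
sumSB-zero (suc k) f f≡𝟘 = cong₂ _+ˢ_ (f≡𝟘 zero) (sumSB-zero k (f ∘ suc) (f≡𝟘 ∘ suc))

sumSB-zero⁻¹ : ∀ k (f : Fin k → SB) → sumSB k f ≡ 𝟘 → ∀ j → f j ≡ 𝟘
sumSB-zero⁻¹ (suc k) f sum≡𝟘 zero    = proj₁ (+ˢ-zero⁻¹ (f zero) _ sum≡𝟘)
sumSB-zero⁻¹ (suc k) f sum≡𝟘 (suc j) = sumSB-zero⁻¹ k (f ∘ suc) (proj₂ (+ˢ-zero⁻¹ (f zero) _ sum≡𝟘)) j

sumSB-punchIn : ∀ k (f : Fin (suc k) → SB) j → sumSB (suc k) f ≡ f j +ˢ sumSB k (f ∘ punchIn j)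
sumSB-punchIn k       f zero    = refl
sumSB-punchIn (suc k) f (suc j) = begin
  f zero +ˢ sumSB (suc k) (f ∘ suc)
    ≡⟨ cong (f zero +ˢ_) (sumSB-punchIn k (f ∘ suc) j) ⟩
  f zero +ˢ (f (suc j) +ˢ sumSB k (f ∘ suc ∘ punchIn j))
    ≡⟨ +ˢ-leftComm (f zero) (f (suc j)) _ ⟩
  f (suc j) +ˢ (f zero +ˢ sumSB k (f ∘ suc ∘ punchIn j)) ∎
  where open ≡-Reasoning

sumSB-single : ∀ k (f : Fin k → SB) j → f j ≡ 𝟙 → (∀ s → s ≢ j → f s ≡ 𝟘) → sumSB k f ≡ 𝟙
sumSB-single (suc k) f j fj≡𝟙 others = begin
  sumSB (suc k) f                       ≡⟨ sumSB-punchIn k f j ⟩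
  f j +ˢ sumSB k (f ∘ punchIn j)        ≡⟨ cong₂ _+ˢ_ fj≡𝟙 (sumSB-zero k _ (λ t → others _ (punchInᵢ≢i j t))) ⟩
  𝟙 ∎
  where open ≡-Reasoning

sumSB-one⁻¹ : ∀ k (f : Fin k → SB) → sumSB k f ≡ 𝟙 → Σ[ j ∈ Fin k ] f j ≡ 𝟙 × (∀ s → s ≢ j → f s ≡ 𝟘)
sumSB-one⁻¹ (suc k) f sum≡𝟙 with +ˢ-one⁻¹ (f zero) _ sum≡𝟙
... | inj₂ (head≡𝟙 , tail≡𝟘) =
  zero , head≡𝟙 , λ { zero 0≢0 → contradiction refl 0≢0 ; (suc s) _ → sumSB-zero⁻¹ k (f ∘ suc) tail≡𝟘 s }
... | inj₁ (head≡𝟘 , tail≡𝟙) with sumSB-one⁻¹ k (f ∘ suc) tail≡𝟙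
...   | j , fj≡𝟙 , others = suc j , fj≡𝟙 , λ { zero _ → head≡𝟘 ; (suc s) s≢j → others s (s≢j ∘ cong suc) }

toSB-not≡𝟘 : ∀ b → toSB (not b) ≡ 𝟘 → b ≡ true
toSB-not≡𝟘 true _ = refl

toSB-not≡𝟙 : ∀ b → toSB (not b) ≡ 𝟙 → b ≡ false
toSB-not≡𝟙 false _ = refl

ZeroOrGhost? : ∀ x → Dec (ZeroOrGhost x)
ZeroOrGhost? 𝟘  = yes tt
ZeroOrGhost? 𝟙  = no (λ ())
ZeroOrGhost? 𝟙ν = yes tt

ghost⇒≢𝟙 : ∀ {x} → ZeroOrGhost x → x ≢ 𝟙
ghost⇒≢𝟙 ghost refl = ghost

¬ghost⇒≡𝟙 : ∀ x → ¬ ZeroOrGhost x → x ≡ 𝟙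
¬ghost⇒≡𝟙 𝟘  ¬ghost = contradiction tt ¬ghost
¬ghost⇒≡𝟙 𝟙  ¬ghost = refl
¬ghost⇒≡𝟙 𝟙ν ¬ghost = contradiction tt ¬ghost

-- Removing one vector from an independent family leaves an independent family:
-- a dependency of the rest extends by the coefficient 0.
independent-punchIn : ∀ {n} {U : VSet n} {k} (C : Fin (suc k) → Fin n → SB) j →
  Independent U (suc k) C → Independent U k (C ∘ punchIn j)
independent-punchIn {U = U} {k} C j independent (λs , (t , λt) , ghost) =
  independent (λs′ , (punchIn j t , trans (insertAt-punchIn λs j false t) λt) , ghost′)
  where
    λs′ : Fin (suc k) → Bool
    λs′ = insertAt λs j false
    extendedSum : ∀ i → sumSB (suc k) (λ s → toSB (λs′ s) *ˢ C s i)
                       ≡ sumSB k (λ t → toSB (λs t) *ˢ C (punchIn j t) i)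
    extendedSum i = begin
      sumSB (suc k) (λ s → toSB (λs′ s) *ˢ C s i)
        ≡⟨ sumSB-punchIn k (λ s → toSB (λs′ s) *ˢ C s i) j ⟩
      (toSB (λs′ j) *ˢ C j i) +ˢ sumSB k (λ t → toSB (λs′ (punchIn j t)) *ˢ C (punchIn j t) i)
        ≡⟨ cong₂ _+ˢ_ (cong (λ b → toSB b *ˢ C j i) (insertAt-lookup λs j false))
                      (sumSB-cong k (λ t → cong (λ b → toSB b *ˢ C (punchIn j t) i) (insertAt-punchIn λs j false t))) ⟩
      sumSB k (λ t → toSB (λs t) *ˢ C (punchIn j t) i) ∎
      where open ≡-Reasoning
    ghost′ : ∀ i → i ∈ U → ZeroOrGhost (sumSB (suc k) (λ s → toSB (λs′ s) *ˢ C s i))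
    ghost′ i i∈U = subst ZeroOrGhost (≡-sym (extendedSum i)) (ghost i i∈U)

-- A nonempty independent family has a pivot row in U: a coordinate in which exactly one
-- vector is 𝟙 and all others are 𝟘 (otherwise the sum of all vectors is a dependency).
pivotRow : ∀ {n} {U : VSet n} {k} (C : Fin (suc k) → Fin n → SB) → Independent U (suc k) C →
  Σ[ i ∈ Fin n ] i ∈ U × Σ[ j ∈ Fin (suc k) ] C j i ≡ 𝟙 × (∀ s → s ≢ j → C s i ≡ 𝟘)
pivotRow {n} {U} {k} C independent = i , i∈U , sumSB-one⁻¹ (suc k) (λ s → C s i) (¬ghost⇒≡𝟙 _ ¬ghost)
  where
    GhostRow : Fin n → Set
    GhostRow i = i ∈ U → ZeroOrGhost (sumSB (suc k) (λ s → C s i))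
    someRowNotGhost : Σ[ i ∈ Fin n ] ¬ GhostRow i
    someRowNotGhost = ¬∀⟶∃¬ n GhostRow (λ i → (U i ≟ᵇ true) →-dec ZeroOrGhost? _)
                              (λ allGhost → independent ((λ _ → true) , (zero , refl) , allGhost))
    i : Fin n
    i = proj₁ someRowNotGhost
    i∈U : i ∈ U
    i∈U = decidable-stable (U i ≟ᵇ true) (λ i∉U → proj₂ someRowNotGhost (λ i∈U → contradiction i∈U i∉U))
    ¬ghost : ¬ ZeroOrGhost (sumSB (suc k) (λ s → C s i))
    ¬ghost ghost = proj₂ someRowNotGhost (λ _ → ghost)

punchIn-elim : ∀ {k} (j : Fin (suc k)) (P : Fin (suc k) → Set) → P j → (∀ t → P (punchIn j t)) → ∀ s → P s
punchIn-elim j P Pj Ppunched s with j ≟ s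
... | yes refl = Pj
... | no j≢s   = subst P (punchIn-punchOut j≢s) (Ppunched (punchOut j≢s))

insertAt-all : ∀ {A : Set} (P : A → Set) {k} (xs : Fin k → A) j x → P x → (∀ t → P (xs t)) →
  ∀ s → P (insertAt xs j x s)
insertAt-all P xs j x Px Pxs = punchIn-elim j (P ∘ insertAt xs j x)
  (subst P (≡-sym (insertAt-lookup xs j x)) Px)
  (λ t → subst P (≡-sym (insertAt-punchIn xs j x t)) (Pxs t))

module _ {A : Set} {_≼_ : Rel A 0ℓ} (≼-isTotalPreorder : IsTotalPreorder _≡_ _≼_) where
  open IsTotalPreorder ≼-isTotalPreorder using (total) renaming (refl to ≼-refl; trans to ≼-trans)

  least : ∀ {k} (f : Fin k → A) (S : Fin k → Bool) → (∃[ j ] S j ≡ true) →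
          Σ[ t ∈ Fin k ] S t ≡ true × (∀ s → S s ≡ true → f t ≼ f s)
  least {suc k} f S nonempty with any? (λ j → S (suc j) ≟ᵇ true)
  ... | no tailEmpty = zero , headIn nonempty , λ { zero _ → ≼-refl ; (suc s) Ss → contradiction (s , Ss) tailEmpty }
    where
      headIn : ∃[ j ] S j ≡ true → S zero ≡ true
      headIn (zero  , S0) = S0
      headIn (suc j , Sj) = contradiction (j , Sj) tailEmpty
  ... | yes tailNonempty with least (f ∘ suc) (S ∘ suc) tailNonempty | S zero in S0
  ...   | t , St , tLeast | false = suc t , St , λ
          { zero S0′ → contradiction (trans (≡-sym S0) S0′) (λ ()) ; (suc s) Ss → tLeast s Ss }
  ...   | t , St , tLeast | true with total (f zero) (f (suc t))
  ...     | inj₁ 0≼t = zero  , S0 , λ { zero _ → ≼-refl ; (suc s) Ss → ≼-trans 0≼t (tLeast s Ss) }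
  ...     | inj₂ t≼0 = suc t , St , λ { zero _ → t≼0    ; (suc s) Ss → tLeast s Ss }

≥-isTotalPreorder : IsTotalPreorder _≡_ _≥_
≥-isTotalPreorder = Flip.isTotalPreorder ≤-isTotalPreorder

greatest : ∀ {k} (f : Fin (suc k) → ℕ) → Σ[ t ∈ Fin (suc k) ] (∀ s → f s ≤ f t)
greatest f with least ≥-isTotalPreorder f (λ _ → true) (zero , refl)
... | t , _ , tGreatest = t , λ s → tGreatest s refl

minus2-in : ∀ {n} {v w u : Fin n} → u ≢ v → u ≢ w → u ∈ minus2 v w
minus2-in {v = v} {w} {u} u≢v u≢w with u ≟ v | u ≟ w
... | yes u≡v | _       = contradiction u≡v u≢v
... | no _    | yes u≡w = contradiction u≡w u≢w
... | no _    | no _    = refl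

distinctBools : ∀ x y → x ≢ y → (x ≡ false × y ≡ true) ⊎ (y ≡ false × x ≡ true)
distinctBools false false x≢y = contradiction refl x≢y
distinctBools false true  _   = inj₁ (refl , refl)
distinctBools true  false _   = inj₂ (refl , refl)
distinctBools true  true  x≢y = contradiction refl x≢y

module _ {n : ℕ} (G : Graph n) where

  columns : ∀ {k} → (Fin k → Fin n) → Fin k → Fin n → SB
  columns col t i = Ac G i (col t)

  Ac-sym : ∀ i j → Ac G i j ≡ Ac G j i
  Ac-sym i j = cong (toSB ∘ not) (Graph.sym G i j)

  adj⇒Ac≡𝟘 : ∀ i j → adj G i j ≡ true → Ac G i j ≡ 𝟘
  adj⇒Ac≡𝟘 i j ij = cong (toSB ∘ not) ij

  ¬adj⇒Ac≡𝟙 : ∀ i j → adj G i j ≡ false → Ac G i j ≡ 𝟙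
  ¬adj⇒Ac≡𝟙 i j ¬ij = cong (toSB ∘ not) ¬ij

  Ac≡𝟘⇒adj : ∀ i j → Ac G i j ≡ 𝟘 → adj G j i ≡ true
  Ac≡𝟘⇒adj i j = trans (Graph.sym G j i) ∘ toSB-not≡𝟘 (adj G i j)

  Ac≡𝟙⇒¬adj : ∀ i j → Ac G i j ≡ 𝟙 → adj G j i ≡ false
  Ac≡𝟙⇒¬adj i j = trans (Graph.sym G j i) ∘ toSB-not≡𝟙 (adj G i j)

  record Triangular (R : Rel ℕ 0ℓ) {k} (col row : Fin k → Fin n) (key : Fin k → ℕ) : Set where
    field
      diagonal  : ∀ t → Ac G (row t) (col t) ≡ 𝟙
      vanishing : ∀ t s → t ≢ s → R (key t) (key s) → Ac G (row t) (col s) ≡ 𝟘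

  module _ {R : Rel ℕ 0ℓ} {k} {col row : Fin k → Fin n} {key : Fin k → ℕ} (tri : Triangular R col row key) where
    open Triangular tri

    -- Distinct columns of a triangular family differ: if key t ≼ key s then row t
    -- separates them.
    distinct-columns : ∀ {t s} → t ≢ s → R (key t) (key s) → col t ≢ col s
    distinct-columns {t} {s} t≢s t≼s col-t≡col-s = 𝟘≢𝟙 (begin
      𝟘                    ≡⟨ ≡-sym (vanishing t s t≢s t≼s) ⟩
      Ac G (row t) (col s) ≡⟨ cong (Ac G (row t)) (≡-sym col-t≡col-s) ⟩
      Ac G (row t) (col t) ≡⟨ diagonal t ⟩
      𝟙 ∎)
      where
        open ≡-Reasoning
        𝟘≢𝟙 : 𝟘 ≢ 𝟙
        𝟘≢𝟙 ()

    triangular-injective : Total R → Injective _≡_ _≡_ col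
    triangular-injective total {t} {s} col-t≡col-s with t ≟ s
    ... | yes t≡s = t≡s
    ... | no t≢s with total (key t) (key s)
    ...   | inj₁ t≼s = contradiction col-t≡col-s (distinct-columns t≢s t≼s)
    ...   | inj₂ s≼t = contradiction (≡-sym col-t≡col-s) (distinct-columns (t≢s ∘ ≡-sym) s≼t)

    -- Triangular columns are independent on any row set containing the pivot rows: in a
    -- nonzero combination, the pivot row of a least-key column in the support sums to 𝟙.
    triangular⇒independent : ∀ {U} → IsTotalPreorder _≡_ R → (∀ t → row t ∈ U) →
      Independent U k (columns col)
    triangular⇒independent isTotalPreorder row∈U (λs , nonzero , ghost)
      with least isTotalPreorder key λs nonzero
    ... | t , λt , tLeast = ghost⇒≢𝟙 (ghost (row t) (row∈U t)) (sumSB-single k _ t pivot others)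
      where
        pivot : toSB (λs t) *ˢ Ac G (row t) (col t) ≡ 𝟙
        pivot rewrite λt = diagonal t
        others : ∀ s → s ≢ t → toSB (λs s) *ˢ Ac G (row t) (col s) ≡ 𝟘
        others s s≢t with λs s in λs≡
        ... | false = refl
        ... | true  = vanishing t s (s≢t ∘ ≡-sym) (tLeast s λs≡)

    -- A^c is symmetric, so pivot rows and columns may be exchanged, reversing the order.
    transpose : Triangular (flip R) row col key
    transpose = record
      { diagonal  = λ t → trans (Ac-sym (col t) (row t)) (diagonal t)
      ; vanishing = λ t s t≢s s≼t → trans (Ac-sym (col t) (row s)) (vanishing s t (t≢s ∘ ≡-sym) s≼t)
      }

    reindex : ∀ {k′} (e : Fin k′ → Fin k) → Injective _≡_ _≡_ e → Triangular R (col ∘ e) (row ∘ e) (key ∘ e)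
    reindex e e-injective = record
      { diagonal  = diagonal ∘ e
      ; vanishing = λ t s t≢s → vanishing (e t) (e s) (t≢s ∘ e-injective)
      }

  addPivot : ∀ {k} {col : Fin (suc k) → Fin n} {row : Fin k → Fin n} {key : Fin k → ℕ} j i →
    Triangular _≤_ (col ∘ punchIn j) row key →
    Ac G i (col j) ≡ 𝟙 → (∀ t → Ac G i (col (punchIn j t)) ≡ 𝟘) →
    Triangular _≤_ col (insertAt row j i) (insertAt (suc ∘ key) j 0)
  addPivot {k} {col} {row} {key} j i tri pivot others = record
    { diagonal  = punchIn-elim j (λ t → Ac G (insertAt row j i t) (col t) ≡ 𝟙)
                    (trans (cong (λ r → Ac G r (col j)) (insertAt-lookup row j i)) pivot)
                    (λ t → trans (cong (λ r → Ac G r (col (punchIn j t))) (insertAt-punchIn row j i t)) (diagonal t))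
    ; vanishing = punchIn-elim j Vanishes fromPivot fromOldRow
    }
    where
      open Triangular tri
      Vanishes : Fin (suc k) → Set
      Vanishes t = ∀ s → t ≢ s → insertAt (suc ∘ key) j 0 t ≤ insertAt (suc ∘ key) j 0 s →
                   Ac G (insertAt row j i t) (col s) ≡ 𝟘
      fromPivot : Vanishes j
      fromPivot s j≢s _ = trans (cong (λ r → Ac G r (col s)) (insertAt-lookup row j i))
        (punchIn-elim j (λ s → j ≢ s → Ac G i (col s) ≡ 𝟘) (λ j≢j → contradiction refl j≢j) (λ t _ → others t) s j≢s)
      fromOldRow : ∀ t → Vanishes (punchIn j t)
      fromOldRow t = punchIn-elim j _ belowPivot belowOld
        where
          rowAt : insertAt row j i (punchIn j t) ≡ row t
          rowAt = insertAt-punchIn row j i t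
          keyAt : insertAt (suc ∘ key) j 0 (punchIn j t) ≡ suc (key t)
          keyAt = insertAt-punchIn (suc ∘ key) j 0 t
          belowPivot : punchIn j t ≢ j → insertAt (suc ∘ key) j 0 (punchIn j t) ≤ insertAt (suc ∘ key) j 0 j →
                       Ac G (insertAt row j i (punchIn j t)) (col j) ≡ 𝟘
          belowPivot _ le with () ← subst₂ _≤_ keyAt (insertAt-lookup (suc ∘ key) j 0) le
          belowOld : ∀ s → punchIn j t ≢ punchIn j s →
                     insertAt (suc ∘ key) j 0 (punchIn j t) ≤ insertAt (suc ∘ key) j 0 (punchIn j s) →
                     Ac G (insertAt row j i (punchIn j t)) (col (punchIn j s)) ≡ 𝟘
          belowOld s t≢s le with s≤s key-t≤key-s ← subst₂ _≤_ keyAt (insertAt-punchIn (suc ∘ key) j 0 s) le =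
            trans (cong (λ r → Ac G r (col (punchIn j s))) rowAt)
                  (vanishing t s (t≢s ∘ cong (punchIn j)) key-t≤key-s)

  -- Every independent family of columns is triangular for ≤, with pivot rows in U:
  -- take a pivot row, give its column the least key and recurse on the other columns.
  independent⇒triangular : ∀ {U} k (col : Fin k → Fin n) → Independent U k (columns col) →
    Σ[ row ∈ (Fin k → Fin n) ] Σ[ key ∈ (Fin k → ℕ) ] (∀ t → row t ∈ U) × Triangular _≤_ col row key
  independent⇒triangular zero col _ =
    (λ ()) , (λ ()) , (λ ()) , record { diagonal = λ () ; vanishing = λ () }
  independent⇒triangular {U} (suc k) col independent with pivotRow (columns col) independent
  ... | i , i∈U , j , pivot , others
    with independent⇒triangular k (col ∘ punchIn j) (independent-punchIn (columns col) j independent)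
  ...   | row , key , row∈U , tri =
    insertAt row j i , insertAt (suc ∘ key) j 0 ,
    insertAt-all (_∈ U) row j i i∈U row∈U ,
    addPivot j i tri pivot (λ t → others (punchIn j t) (punchInᵢ≢i j t))

  record TriangularFamily (U J : VSet n) (R : Rel ℕ 0ℓ) (k : ℕ) : Set where
    field
      col        : Fin k → Fin n
      row        : Fin k → Fin n
      key        : Fin k → ℕ
      col∈J      : ∀ t → col t ∈ J
      row∈U      : ∀ t → row t ∈ U
      triangular : Triangular R col row key

  crk⇒family : ∀ U J {m} → CRkAtLeast G U J m → ∃[ k ] m ≤ k × TriangularFamily U J _≤_ k
  crk⇒family U J (k , m≤k , col , _ , col∈J , independent)
    with independent⇒triangular k col independent
  ... | row , key , row∈U , tri = k , m≤k , record
    { col = col ; row = row ; key = key ; col∈J = col∈J ; row∈U = row∈U ; triangular = tri }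

  family⇒crk : ∀ {U J R m k} → IsTotalPreorder _≡_ R → m ≤ k → TriangularFamily U J R k → CRkAtLeast G U J m
  family⇒crk {k = k} isTotalPreorder m≤k F =
    k , m≤k , col , triangular-injective triangular (IsTotalPreorder.total isTotalPreorder) , col∈J ,
    triangular⇒independent triangular isTotalPreorder row∈U
    where open TriangularFamily F

  -- Let b and a carry the largest and second largest keys of a
  -- triangular family.  The pivot rows of all other columns lie in St(col a) ∩ St(col b),
  -- row a lies in St(col b) but not in St(col a), and the other pivots, transposed, form
  -- a triangular family in G-{col a, col b}.
  peelTwo : ∀ {k} → TriangularFamily full full _≤_ (suc (suc k)) →
    ∃[ v ] ∃[ w ] (StDiffer G v w × TriangularFamily (minus2 v w) (commonNbrs G v w) _≥_ k)
  peelTwo {k} F = col a , col b , separating , record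
    { col        = row ∘ e
    ; row        = col ∘ e
    ; key        = key ∘ e
    ; col∈J      = λ t → cong₂ _∧_ (adjacentTo a (e≢a t) (keyBelowA t))
                                   (adjacentTo b (e≢b t) (≤-trans (keyBelowA t) (bTop a)))
    ; row∈U      = λ t → minus2-in (e≢a t ∘ col-injective) (e≢b t ∘ col-injective)
    ; triangular = transpose (reindex triangular e e-injective)
    }
    where
      open TriangularFamily F
      open Triangular triangular
      b : Fin (suc (suc k))
      b = proj₁ (greatest key)
      bTop : ∀ s → key s ≤ key b
      bTop = proj₂ (greatest key)
      a′ : Fin (suc k)
      a′ = proj₁ (greatest (key ∘ punchIn b))
      a : Fin (suc (suc k))
      a = punchIn b a′
      -- the columns other than a and b
      e : Fin k → Fin (suc (suc k))
      e = punchIn b ∘ punchIn a′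
      keyBelowA : ∀ t → key (e t) ≤ key a
      keyBelowA t = proj₂ (greatest (key ∘ punchIn b)) (punchIn a′ t)
      e-injective : Injective _≡_ _≡_ e
      e-injective = punchIn-injective a′ _ _ ∘ punchIn-injective b _ _
      e≢a : ∀ t → e t ≢ a
      e≢a t = punchInᵢ≢i a′ t ∘ punchIn-injective b _ _
      e≢b : ∀ t → e t ≢ b
      e≢b t = punchInᵢ≢i b _
      col-injective : Injective _≡_ _≡_ col
      col-injective = triangular-injective triangular ≤-total
      adjacentTo : ∀ c {t} → t ≢ c → key t ≤ key c → adj G (col c) (row t) ≡ true
      adjacentTo c {t} t≢c t≤c = Ac≡𝟘⇒adj (row t) (col c) (vanishing t c t≢c t≤c)
      separating : StDiffer G (col a) (col b)
      separating sameNbrs = contradiction (begin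
        false                ≡⟨ ≡-sym (Ac≡𝟙⇒¬adj (row a) (col a) (diagonal a)) ⟩
        adj G (col a) (row a) ≡⟨ sameNbrs (row a) ⟩
        adj G (col b) (row a) ≡⟨ adjacentTo b (punchInᵢ≢i b a′) (bTop a) ⟩
        true ∎) (λ ())
        where open ≡-Reasoning

  -- Backward construction.  If u ∈ St(w) ∖ St(v) and the columns of a triangular family
  -- lie in St(v) ∩ St(w), adjoin the pivots (column u, row v) and (column w, row w) and
  -- transpose.
  attachTwo : ∀ {U J k v w u} → adj G v u ≡ false → adj G w u ≡ true →
    (F : TriangularFamily U J _≤_ k) →
    (∀ t → adj G v (TriangularFamily.col F t) ≡ true) → (∀ t → adj G w (TriangularFamily.col F t) ≡ true) →
    TriangularFamily full full _≥_ (suc (suc k))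
  attachTwo {v = v} {w} {u} ¬vu wu F vAdj wAdj = record
    { col        = insertAt (insertAt row zero v) zero w
    ; row        = insertAt (insertAt col zero u) zero w
    ; key        = insertAt (suc ∘ insertAt (suc ∘ key) zero 0) zero 0
    ; col∈J      = λ _ → refl
    ; row∈U      = λ _ → refl
    ; triangular = transpose (addPivot zero w withU (¬adj⇒Ac≡𝟙 w w (irrefl G w)) wVanishes)
    }
    where
      open TriangularFamily F
      withU : Triangular _≤_ (insertAt col zero u) (insertAt row zero v) (insertAt (suc ∘ key) zero 0)
      withU = addPivot zero v triangular (¬adj⇒Ac≡𝟙 v u ¬vu) (λ t → adj⇒Ac≡𝟘 v (col t) (vAdj t))
      wVanishes : ∀ t → Ac G w (insertAt col zero u t) ≡ 𝟘
      wVanishes zero    = adj⇒Ac≡𝟘 w u wu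
      wVanishes (suc t) = adj⇒Ac≡𝟘 w (col t) (wAdj t)

  forward : ∀ {m} → 2 ≤ m → CRkAtLeast G full full m →
    ∃[ v ] ∃[ w ] (StDiffer G v w × CRkAtLeast G (minus2 v w) (commonNbrs G v w) (m ∸ 2))
  forward 2≤m crk with crk⇒family full full crk
  ... | zero , m≤0 , _ = contradiction (≤-trans 2≤m m≤0) (λ ())
  ... | suc zero , m≤1 , _ = contradiction (≤-trans 2≤m m≤1) (λ { (s≤s ()) })
  ... | suc (suc k) , m≤k , F with peelTwo F
  ...   | v , w , separating , F′ = v , w , separating , family⇒crk ≥-isTotalPreorder (∸-monoˡ-≤ 2 m≤k) F′

  -- The converse holds for every m: m ≤ 2 + (m ∸ 2).
  backward : ∀ {m} → (∃[ v ] ∃[ w ] (StDiffer G v w × CRkAtLeast G (minus2 v w) (commonNbrs G v w) (m ∸ 2))) →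
    CRkAtLeast G full full m
  backward {m} (v , w , differ , crk) with crk⇒family (minus2 v w) (commonNbrs G v w) crk | ¬∀⟶∃¬ n _ (λ u → adj G v u ≟ᵇ adj G w u) differ
  ... | k , m∸2≤k , F | u , differAtU =
    family⇒crk ≥-isTotalPreorder m≤2+k (extend (distinctBools _ _ differAtU))
    where
      open TriangularFamily F
      m≤2+k : m ≤ suc (suc k)
      m≤2+k = ≤-trans (m≤n+m∸n m 2) (+-monoʳ-≤ 2 m∸2≤k)
      vAdj : ∀ t → adj G v (col t) ≡ true
      vAdj t = ∧-conicalˡ (adj G v (col t)) (adj G w (col t)) (col∈J t)
      wAdj : ∀ t → adj G w (col t) ≡ true
      wAdj t = ∧-conicalʳ (adj G v (col t)) (adj G w (col t)) (col∈J t)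
      extend : (adj G v u ≡ false × adj G w u ≡ true) ⊎ (adj G w u ≡ false × adj G v u ≡ true) →
               TriangularFamily full full _≥_ (suc (suc k))
      extend (inj₁ (¬vu , wu)) = attachTwo ¬vu wu F vAdj wAdj
      extend (inj₂ (¬wu , vu)) = attachTwo ¬wu vu F wAdj vAdj

theorem3p10 : ∀ {n : ℕ} (G : Graph n) (m : ℕ) → 2 ≤ m →
    CRkAtLeast G full full m ⇔
    (∃[ v ] ∃[ w ] (StDiffer G v w × CRkAtLeast G (minus2 v w) (commonNbrs G v w) (m ∸ 2)))
theorem3p10 G m 2≤m = mk⇔ (forward G 2≤m) (backward G)
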